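{- Let $G=(V,E)$ be a finite undirected graph and let $\gamma$ be an extreme point of the convex set $\Gamma_{\text{fec}}$ of fractional edge covers of $G$. Then any connected component of the subgraph $\mathrm{supp}\,\gamma$ that contains a pendant edge is a substar.
   Context: A fractional edge cover is $\gamma\in\mathbb{R}^E_{\ge0}$ with $\sum_{e\in\delta(v)}\gamma(e)\ge1$ for all $v\in V$, where $\delta(v)$ is the set of edges incident to $v$. $\mathrm{supp}\,\gamma=\{e\in E:\gamma(e)>0\}$, viewed as a subgraph. A pendant edge of a subgraph $H$ is an edge incident to a vertex of degree one in $H$. A substar is a set of edges contained in some $\delta(v)$ (all edges share a common vertex).
   Formalization: The point γ, the fractional edge covers in $\Gamma_{\text{fec}}$ and the coefficients of the convex combinations defining an extreme point are rational rather than real. -}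

module Defs where

open import Data.Nat using (ℕ)
open import Data.Fin using (Fin; _≟_)
open import Data.List using (List; foldr; map; allFin)
open import Data.Product using (_×_; proj₁; proj₂; Σ; ∃; _,_)
open import Data.Sum using (_⊎_)
open import Relation.Nullary using (¬_; Dec; yes; no)
open import Relation.Nullary.Decidable using (_⊎-dec_)
open import Relation.Binary.PropositionalEquality using (_≡_)
open import Data.Rational using (ℚ; 0ℚ; 1ℚ; _+_; _*_; _-_; _≤_; _<_)
import Data.Rational.Properties as ℚP

record Graph : Set where
  field
    n     : ℕ
    m     : ℕ
    ends  : Fin m → Fin n × Fin n
    loopless : ∀ e → ¬ (proj₁ (ends e) ≡ proj₂ (ends e))
    simple : ∀ e e′ →
      ((proj₁ (ends e) ≡ proj₁ (ends e′) × proj₂ (ends e) ≡ proj₂ (ends e′)) ⊎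
       (proj₁ (ends e) ≡ proj₂ (ends e′) × proj₂ (ends e) ≡ proj₁ (ends e′))) →
      e ≡ e′

module _ (G : Graph) where
  open Graph G

  Incident : Fin m → Fin n → Set
  Incident e v = proj₁ (ends e) ≡ v ⊎ proj₂ (ends e) ≡ v

  incident? : ∀ e v → Dec (Incident e v)
  incident? e v = (proj₁ (ends e) ≟ v) ⊎-dec (proj₂ (ends e) ≟ v)

  load : (Fin m → ℚ) → Fin n → ℚ
  load γ v = foldr _+_ 0ℚ (map (λ e → term e (incident? e v)) (allFin m))
    where
      term : (e : Fin m) → Dec (Incident e v) → ℚ
      term e (yes _) = γ e
      term e (no _)  = 0ℚ

  IsFEC : (Fin m → ℚ) → Set
  IsFEC γ = (∀ e → 0ℚ ≤ γ e) × (∀ v → 1ℚ ≤ load γ v)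

  IsExtreme : (Fin m → ℚ) → Set
  IsExtreme γ = IsFEC γ ×
    (∀ (α β : Fin m → ℚ) (t : ℚ) → IsFEC α → IsFEC β →
       0ℚ < t → t < 1ℚ →
       (∀ e → γ e ≡ t * α e + (1ℚ - t) * β e) →
       ∀ e → α e ≡ β e)

  Supp : (Fin m → ℚ) → Fin m → Set
  Supp γ e = 0ℚ < γ e

  data Reach (γ : Fin m → ℚ) : Fin n → Fin n → Set where
    here : ∀ {u} → Reach γ u u
    step : ∀ {u w} (e : Fin m) → Supp γ e →
           Incident e u → Incident e w → ∀ {x} → Reach γ w x → Reach γ u x

  PendantAt : (Fin m → ℚ) → Fin m → Fin n → Set
  PendantAt γ e v = Supp γ e × Incident e v ×
    (∀ e′ → Supp γ e′ → Incident e′ v → e′ ≡ e)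

  InComponentOf : (Fin m → ℚ) → Fin m → Fin m → Set
  InComponentOf γ e e′ = Supp γ e′ × Reach γ (proj₁ (ends e)) (proj₁ (ends e′))

  ComponentIsSubstar : (Fin m → ℚ) → Fin m → Set
  ComponentIsSubstar γ e = ∃ λ c → ∀ e′ → InComponentOf γ e e′ → Incident e′ c

-- For an extreme point γ, every support neighbour of a vertex u with slack constraint is a leaf of
-- supp γ.  Otherwise walk from u along support edges, weighting them alternately +1 and −1.  Through
-- a tight vertex the walk can always continue: two support edges at a tight vertex both weigh less
-- than 1, and a vertex whose only support edge weighs less than 1 is uncovered.  As the graph is
-- finite, the walk reaches a second slack vertex or closes a cycle.  Either way the signed edge
-- vector d (for a cycle, combined with the path leading to it) changes the load only at slack
-- vertices, so γ ± εd are fractional edge covers for small ε > 0, contradicting extremality.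
-- If e = vu is pendant at v then γ(e) ≥ 1, so u is slack as soon as it has a second support edge;
-- in every case the component of e is a star centred at u.

{-# OPTIONS --safe #-}
module Submission where

open import Defs
open import Algebra.Bundles using (Ring)
open import Data.Empty using (⊥; ⊥-elim)
open import Data.Fin using (Fin; zero; suc; _≟_; punchIn; punchOut) renaming (_<_ to _<ᶠ_)
open import Data.Fin.Properties using (pigeonhole; punchIn-punchOut; punchInᵢ≢i; any?)
open import Data.List using (List; []; _∷_; length; lookup; foldr; map; allFin; tabulate)
open import Data.List.Properties using (map-tabulate)
open import Data.List.Membership.Propositional using (_∈_; _∉_)
open import Data.List.Membership.Propositional.Properties using (∈-lookup)
open import Data.List.Relation.Binary.Subset.Propositional using (_⊆_)
open import Data.List.Relation.Unary.All.Properties using (¬Any⇒All¬)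
open import Data.List.Relation.Unary.Any using (here; there)
import Data.List.Relation.Unary.Any as Any
import Data.List.Relation.Unary.All as All
open import Data.List.Relation.Unary.AllPairs using ([]; _∷_)
open import Data.List.Relation.Unary.Unique.Propositional using (Unique)
import Data.Nat as ℕ
import Data.Nat.Properties as ℕP
open import Data.Product using (_×_; _,_; proj₁; proj₂; ∃)
open import Data.Rational using (ℚ; 0ℚ; 1ℚ; _+_; _*_; _-_; -_; _≤_; _<_; ∣_∣; 1/_; _⊓_; ½; positive; Positive; NonNegative; NonZero)
import Data.Rational.Properties as ℚP
open import Data.Rational.Solver using (module +-*-Solver)
open import Data.Sum using (_⊎_; inj₁; inj₂; [_,_]′; map₂; fromInj₁)
open import Function using (_∘_)
open import Relation.Binary.PropositionalEquality
open import Relation.Nullary using (¬_; Dec; yes; no)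
open import Relation.Nullary.Decidable using (toWitness; _×-dec_; ¬?)

open +-*-Solver using (solve; _:+_; _:*_; _:-_; :-_; _:=_; con)
open import Algebra.Properties.Semiring.Sum (Ring.semiring ℚP.+-*-ring)
  using (sum; sum-cong-≗; sum-replicate-zero; sum-remove; ∑-distrib-+; *-distribˡ-sum)

_if_ : ∀ {p} {P : Set p} → ℚ → Dec P → ℚ
c if yes _ = c
c if no _  = 0ℚ

δ : ∀ {k} → Fin k → Fin k → ℚ
δ i j = 1ℚ if (i ≟ j)

module _ {p} {P : Set p} where

  if-yes : ∀ {c} (d : Dec P) → P → c if d ≡ c
  if-yes (yes _) _ = refl
  if-yes (no ¬x) x = ⊥-elim (¬x x)

  if-no : ∀ {c} (d : Dec P) → ¬ P → c if d ≡ 0ℚ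
  if-no (yes x) ¬x = ⊥-elim (¬x x)
  if-no (no _)  _  = refl

  if-zero : (d : Dec P) → 0ℚ if d ≡ 0ℚ
  if-zero (yes _) = refl
  if-zero (no _)  = refl

  if-+ : ∀ a b (d : Dec P) → (a + b) if d ≡ (a if d) + (b if d)
  if-+ a b (yes _) = refl
  if-+ a b (no _)  = refl

  if-* : ∀ c a (d : Dec P) → (c * a) if d ≡ c * (a if d)
  if-* c a (yes _) = refl
  if-* c a (no _)  = sym (ℚP.*-zeroʳ c)

  if-nonneg : ∀ {a} (d : Dec P) → 0ℚ ≤ a → 0ℚ ≤ a if d
  if-nonneg (yes _) 0≤a = 0≤a
  if-nonneg (no _)  _   = ℚP.≤-refl

δ-self : ∀ {k} (i : Fin k) → δ i i ≡ 1ℚ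
δ-self i = if-yes (i ≟ i) refl

δ-≢ : ∀ {k} {i j : Fin k} → i ≢ j → δ i j ≡ 0ℚ
δ-≢ {i = i} {j} i≢j = if-no (i ≟ j) i≢j

sum-zero : ∀ {k} {F : Fin k → ℚ} → (∀ i → F i ≡ 0ℚ) → sum F ≡ 0ℚ
sum-zero {k} F≗0 = trans (sum-cong-≗ F≗0) (sum-replicate-zero k)

sum-single : ∀ {k} {F : Fin k → ℚ} i → (∀ j → j ≢ i → F j ≡ 0ℚ) → sum F ≡ F i
sum-single {ℕ.suc k} {F} i vanish = begin
  sum F                     ≡⟨ sum-remove F ⟩
  F i + sum (F ∘ punchIn i) ≡⟨ cong (F i +_) (sum-zero (λ j → vanish (punchIn i j) (punchInᵢ≢i i j))) ⟩
  F i + 0ℚ                  ≡⟨ ℚP.+-identityʳ (F i) ⟩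
  F i                       ∎
  where open ≡-Reasoning

sum-nonneg : ∀ {k} {F : Fin k → ℚ} → (∀ i → 0ℚ ≤ F i) → 0ℚ ≤ sum F
sum-nonneg {ℕ.zero}  F≥0 = ℚP.≤-refl
sum-nonneg {ℕ.suc k} F≥0 = ℚP.+-mono-≤ (F≥0 zero) (sum-nonneg (F≥0 ∘ suc))

term≤sum : ∀ {k} {F : Fin k → ℚ} → (∀ i → 0ℚ ≤ F i) → ∀ i → F i ≤ sum F
term≤sum {ℕ.suc k} {F} F≥0 i = begin
  F i                       ≡⟨ ℚP.+-identityʳ (F i) ⟨
  F i + 0ℚ                  ≤⟨ ℚP.+-monoʳ-≤ (F i) (sum-nonneg (F≥0 ∘ punchIn i)) ⟩
  F i + sum (F ∘ punchIn i) ≡⟨ sum-remove F ⟨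
  sum F                     ∎
  where open ℚP.≤-Reasoning

pair≤sum : ∀ {k} {F : Fin k → ℚ} → (∀ i → 0ℚ ≤ F i) → ∀ {i j} → i ≢ j → F i + F j ≤ sum F
pair≤sum {ℕ.suc k} {F} F≥0 {i} {j} i≢j = begin
  F i + F j                 ≡⟨ cong (λ l → F i + F l) (punchIn-punchOut i≢j) ⟨
  F i + F (punchIn i l)     ≤⟨ ℚP.+-monoʳ-≤ (F i) (term≤sum (F≥0 ∘ punchIn i) l) ⟩
  F i + sum (F ∘ punchIn i) ≡⟨ sum-remove F ⟨
  sum F                     ∎
  where
  open ℚP.≤-Reasoning
  l : Fin k
  l = punchOut i≢j

sum-allFin : ∀ {k} (F : Fin k → ℚ) → foldr _+_ 0ℚ (map F (allFin k)) ≡ sum F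
sum-allFin {k} F = trans (cong (foldr _+_ 0ℚ) (map-tabulate (λ i → i) F)) (foldr-tabulate F)
  where
  foldr-tabulate : ∀ {l} (H : Fin l → ℚ) → foldr _+_ 0ℚ (tabulate H) ≡ sum H
  foldr-tabulate {ℕ.zero}  H = refl
  foldr-tabulate {ℕ.suc l} H = cong (H zero +_) (foldr-tabulate (H ∘ suc))

unique⇒lookup≢ : ∀ {k} {xs : List (Fin k)} → Unique xs → ∀ {i j} → i <ᶠ j → lookup xs i ≢ lookup xs j
unique⇒lookup≢ (x∉xs ∷ _)  {zero}  {suc j} _         = All.lookup x∉xs (∈-lookup j)
unique⇒lookup≢ (_ ∷ unique) {suc i} {suc j} (ℕ.s≤s i<j) = unique⇒lookup≢ unique i<j

unique⇒length≤ : ∀ {k} {xs : List (Fin k)} → Unique xs → length xs ℕ.≤ k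
unique⇒length≤ {k} {xs} unique with length xs ℕ.≤? k
... | yes ≤k = ≤k
... | no  ≰k with pigeonhole (ℕP.≰⇒> ≰k) (lookup xs)
...   | i , j , i<j , same = ⊥-elim (unique⇒lookup≢ unique i<j same)

1≢0 : 1ℚ ≢ 0ℚ
1≢0 ()

0<1 : 0ℚ < 1ℚ
0<1 = ℚP.positive⁻¹ 1ℚ

0<⊓ : ∀ {p q} → 0ℚ < p → 0ℚ < q → 0ℚ < p ⊓ q
0<⊓ {p} {q} 0<p 0<q with ℚP.⊓-sel p q
... | inj₁ p⊓q≡p = subst (0ℚ <_) (sym p⊓q≡p) 0<p
... | inj₂ p⊓q≡q = subst (0ℚ <_) (sym p⊓q≡q) 0<q

p≤q⇒0≤q-p : ∀ {p q} → p ≤ q → 0ℚ ≤ q - p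
p≤q⇒0≤q-p {p} {q} p≤q = subst (_≤ q - p) (ℚP.+-inverseʳ p) (ℚP.+-monoˡ-≤ (- p) p≤q)

p<q⇒0<q-p : ∀ {p q} → p < q → 0ℚ < q - p
p<q⇒0<q-p {p} {q} p<q = subst (_< q - p) (ℚP.+-inverseʳ p) (ℚP.+-monoˡ-< (- p) p<q)

p≤∣p∣ : ∀ p → p ≤ ∣ p ∣
p≤∣p∣ p with ℚP.≤-total 0ℚ p
... | inj₁ 0≤p = ℚP.≤-reflexive (sym (ℚP.0≤p⇒∣p∣≡p 0≤p))
... | inj₂ p≤0 = ℚP.≤-trans p≤0 (ℚP.0≤∣p∣ p)

∣p∣≤q⇒0≤q+p : ∀ {p q} → ∣ p ∣ ≤ q → 0ℚ ≤ q + p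
∣p∣≤q⇒0≤q+p {p} {q} ∣p∣≤q = begin
  0ℚ       ≡⟨ ℚP.+-inverseˡ p ⟨
  - p + p  ≤⟨ ℚP.+-monoˡ-≤ p (p≤∣p∣ (- p)) ⟩
  ∣ - p ∣ + p ≡⟨ cong (_+ p) (ℚP.∣-p∣≡∣p∣ p) ⟩
  ∣ p ∣ + p   ≤⟨ ℚP.+-monoˡ-≤ p ∣p∣≤q ⟩
  q + p    ∎
  where open ℚP.≤-Reasoning

∣p∣≤q-r⇒r≤q+p : ∀ {p q r} → ∣ p ∣ ≤ q - r → r ≤ q + p
∣p∣≤q-r⇒r≤q+p {p} {q} {r} ∣p∣≤q-r = begin
  r               ≡⟨ ℚP.+-identityˡ r ⟨
  0ℚ + r          ≤⟨ ℚP.+-monoˡ-≤ r (∣p∣≤q⇒0≤q+p ∣p∣≤q-r) ⟩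
  (q - r + p) + r ≡⟨ solve 3 (λ p q r → (q :- r :+ p) :+ r := q :+ p) refl p q r ⟩
  q + p           ∎
  where open ℚP.≤-Reasoning

positive-step : ∀ a b → 0ℚ ≤ b → a ≡ 0ℚ ⊎ 0ℚ < b →
                ∃ λ ε → 0ℚ < ε × ∀ {c} → ∣ c ∣ ≤ ε → ∣ c * a ∣ ≤ b
positive-step a b 0≤b (inj₁ refl) = 1ℚ , 0<1 , λ {c} _ → subst (λ x → ∣ x ∣ ≤ b) (sym (ℚP.*-zeroʳ c)) 0≤b
positive-step a b _   (inj₂ 0<b)  = ε , ℚP.positive⁻¹ ε , room
  where
  instance
    ∣a∣≥0 : NonNegative ∣ a ∣
    ∣a∣≥0 = ℚP.∣-∣-nonNeg a
    b>0 : Positive b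
    b>0 = positive 0<b
    1+∣a∣>0 : Positive (1ℚ + ∣ a ∣)
    1+∣a∣>0 = ℚP.pos+nonNeg⇒pos 1ℚ ∣ a ∣
    1+∣a∣≢0 : NonZero (1ℚ + ∣ a ∣)
    1+∣a∣≢0 = ℚP.pos⇒nonZero (1ℚ + ∣ a ∣)
    1/[1+∣a∣]>0 : Positive (1/ (1ℚ + ∣ a ∣))
    1/[1+∣a∣]>0 = ℚP.1/pos⇒pos (1ℚ + ∣ a ∣)
  -- 1 + ∣a∣ rather than ∣a∣ keeps the divisor nonzero without a case split on a.
  ε : ℚ
  ε = b * 1/ (1ℚ + ∣ a ∣)
  instance
    ε>0 : Positive ε
    ε>0 = ℚP.pos*pos⇒pos b (1/ (1ℚ + ∣ a ∣))
    ε≥0 : NonNegative ε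
    ε≥0 = ℚP.pos⇒nonNeg ε
  room : ∀ {c} → ∣ c ∣ ≤ ε → ∣ c * a ∣ ≤ b
  room {c} ∣c∣≤ε = begin
    ∣ c * a ∣                            ≡⟨ ℚP.∣p*q∣≡∣p∣*∣q∣ c a ⟩
    ∣ c ∣ * ∣ a ∣                        ≤⟨ ℚP.*-monoʳ-≤-nonNeg ∣ a ∣ ∣c∣≤ε ⟩
    ε * ∣ a ∣                            ≡⟨ cong (ε *_) (ℚP.+-identityˡ ∣ a ∣) ⟨
    ε * (0ℚ + ∣ a ∣)                     ≤⟨ ℚP.*-monoˡ-≤-nonNeg ε (ℚP.+-monoˡ-≤ ∣ a ∣ (ℚP.<⇒≤ 0<1)) ⟩
    ε * (1ℚ + ∣ a ∣)                     ≡⟨ ℚP.*-assoc b _ _ ⟩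
    b * (1/ (1ℚ + ∣ a ∣) * (1ℚ + ∣ a ∣)) ≡⟨ cong (b *_) (ℚP.*-inverseˡ (1ℚ + ∣ a ∣)) ⟩
    b * 1ℚ                               ≡⟨ ℚP.*-identityʳ b ⟩
    b                                    ∎
    where open ℚP.≤-Reasoning

uniform-step : ∀ {k} (a b : Fin k → ℚ) → (∀ i → 0ℚ ≤ b i) → (∀ i → a i ≡ 0ℚ ⊎ 0ℚ < b i) →
               ∃ λ ε → 0ℚ < ε × ∀ {c} → ∣ c ∣ ≤ ε → ∀ i → ∣ c * a i ∣ ≤ b i
uniform-step {ℕ.zero}  a b _   _       = 1ℚ , 0<1 , λ _ ()
uniform-step {ℕ.suc k} a b b≥0 allowed
  with positive-step (a zero) (b zero) (b≥0 zero) (allowed zero)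
     | uniform-step (a ∘ suc) (b ∘ suc) (b≥0 ∘ suc) (allowed ∘ suc)
... | ε₀ , 0<ε₀ , room₀ | ε₁ , 0<ε₁ , room₁ = ε₀ ⊓ ε₁ , 0<⊓ 0<ε₀ 0<ε₁ , room
  where
  room : ∀ {c} → ∣ c ∣ ≤ ε₀ ⊓ ε₁ → ∀ i → ∣ c * a i ∣ ≤ b i
  room ∣c∣≤ε zero    = room₀ (ℚP.≤-trans ∣c∣≤ε (ℚP.p⊓q≤p ε₀ ε₁))
  room ∣c∣≤ε (suc i) = room₁ (ℚP.≤-trans ∣c∣≤ε (ℚP.p⊓q≤q ε₀ ε₁)) i

*-cancel-pos : ∀ {c x} → 0ℚ < c → c * x ≡ 0ℚ → x ≡ 0ℚ
*-cancel-pos {c} {x} 0<c cx≡0 = begin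
  x                ≡⟨ ℚP.*-identityˡ x ⟨
  1ℚ * x           ≡⟨ cong (_* x) (ℚP.*-inverseˡ c) ⟨
  1/ c * c * x     ≡⟨ ℚP.*-assoc (1/ c) c x ⟩
  1/ c * (c * x)   ≡⟨ cong (1/ c *_) cx≡0 ⟩
  1/ c * 0ℚ        ≡⟨ ℚP.*-zeroʳ (1/ c) ⟩
  0ℚ               ∎
  where
  open ≡-Reasoning
  instance
    c≢0 : NonZero c
    c≢0 = ℚP.pos⇒nonZero c {{positive 0<c}}

opposite-steps-agree : ∀ {ε x y} → 0ℚ < ε → x + ε * y ≡ x + (- ε) * y → y ≡ 0ℚ
opposite-steps-agree {ε} {x} {y} 0<ε agree = *-cancel-pos (ℚP.+-mono-< 0<ε 0<ε) (begin
  (ε + ε) * y                         ≡⟨ solve 3 (λ ε x y → (ε :+ ε) :* y := (x :+ ε :* y) :- (x :+ (:- ε) :* y)) refl ε x y ⟩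
  (x + ε * y) - (x + (- ε) * y)       ≡⟨ cong (_- (x + (- ε) * y)) agree ⟩
  (x + (- ε) * y) - (x + (- ε) * y)   ≡⟨ ℚP.+-inverseʳ (x + (- ε) * y) ⟩
  0ℚ                                  ∎)
  where open ≡-Reasoning

module _ (G : Graph) where
  open Graph G

  Joins : Fin m → Fin n → Fin n → Set
  Joins h a b = (proj₁ (ends h) ≡ a × proj₂ (ends h) ≡ b) ⊎ (proj₁ (ends h) ≡ b × proj₂ (ends h) ≡ a)

  joins-≢ : ∀ {h a b} → Joins h a b → a ≢ b
  joins-≢ {h} (inj₁ (≡a , ≡b)) a≡b = loopless h (trans ≡a (trans a≡b (sym ≡b)))
  joins-≢ {h} (inj₂ (≡b , ≡a)) a≡b = loopless h (trans ≡b (trans (sym a≡b) (sym ≡a)))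

  joins-incidentˡ : ∀ {h a b} → Joins h a b → Incident G h a
  joins-incidentˡ (inj₁ (≡a , _)) = inj₁ ≡a
  joins-incidentˡ (inj₂ (_ , ≡a)) = inj₂ ≡a

  joins-incidentʳ : ∀ {h a b} → Joins h a b → Incident G h b
  joins-incidentʳ (inj₁ (_ , ≡b)) = inj₂ ≡b
  joins-incidentʳ (inj₂ (≡b , _)) = inj₁ ≡b

  joins-endpoints : ∀ {h a b y} → Joins h a b → Incident G h y → y ≡ a ⊎ y ≡ b
  joins-endpoints (inj₁ (≡a , _))  (inj₁ ≡y) = inj₁ (trans (sym ≡y) ≡a)
  joins-endpoints (inj₁ (_  , ≡b)) (inj₂ ≡y) = inj₂ (trans (sym ≡y) ≡b)
  joins-endpoints (inj₂ (≡b , _))  (inj₁ ≡y) = inj₂ (trans (sym ≡y) ≡b)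
  joins-endpoints (inj₂ (_  , ≡a)) (inj₂ ≡y) = inj₁ (trans (sym ≡y) ≡a)

  other-endpoint : ∀ {h a} → Incident G h a → ∃ λ b → Joins h a b
  other-endpoint {h} (inj₁ ≡a) = proj₂ (ends h) , inj₁ (≡a , refl)
  other-endpoint {h} (inj₂ ≡a) = proj₁ (ends h) , inj₂ (refl , ≡a)

  incident⇒joins : ∀ {h a b} → Incident G h a → Incident G h b → a ≢ b → Joins h a b
  incident⇒joins (inj₁ ≡a) (inj₁ ≡b) a≢b = ⊥-elim (a≢b (trans (sym ≡a) ≡b))
  incident⇒joins (inj₁ ≡a) (inj₂ ≡b) _   = inj₁ (≡a , ≡b)
  incident⇒joins (inj₂ ≡a) (inj₁ ≡b) _   = inj₂ (≡b , ≡a)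
  incident⇒joins (inj₂ ≡a) (inj₂ ≡b) a≢b = ⊥-elim (a≢b (trans (sym ≡a) ≡b))

  _↾_ : (Fin m → ℚ) → Fin n → Fin m → ℚ
  (γ ↾ y) f = γ f if incident? G f y

  private
    -- `load` sums a `where`-bound summand that cannot be named; unifying `load` with a `refl` recovers it.
    summand : ∀ {k} {q : ℚ} (F : Fin k → ℚ) → q ≡ foldr _+_ 0ℚ (map F (allFin k)) → Fin k → ℚ
    summand F _ = F

    summand-load : ∀ γ y e → summand _ (refl {x = load G γ y}) e ≡ (γ ↾ y) e
    summand-load γ y e with incident? G e y
    ... | yes _ = refl
    ... | no _  = refl

  load-as-sum : ∀ γ y → load G γ y ≡ sum (γ ↾ y)
  load-as-sum γ y = trans (sum-allFin {m} _) (sum-cong-≗ (summand-load γ y))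

  load-linear : ∀ (a b : Fin m → ℚ) c y → load G (λ f → a f + c * b f) y ≡ load G a y + c * load G b y
  load-linear a b c y = begin
    load G (λ f → a f + c * b f) y                    ≡⟨ load-as-sum _ y ⟩
    sum ((λ f → a f + c * b f) ↾ y)                   ≡⟨ sum-cong-≗ split ⟩
    sum (λ f → (a ↾ y) f + c * (b ↾ y) f)             ≡⟨ ∑-distrib-+ (a ↾ y) (λ f → c * (b ↾ y) f) ⟩
    sum (a ↾ y) + sum (λ f → c * (b ↾ y) f)           ≡⟨ cong (sum (a ↾ y) +_) (*-distribˡ-sum c (b ↾ y)) ⟨
    sum (a ↾ y) + c * sum (b ↾ y)                     ≡⟨ cong₂ (λ l r → l + c * r) (load-as-sum a y) (load-as-sum b y) ⟨
    load G a y + c * load G b y                       ∎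
    where
    open ≡-Reasoning
    split : ∀ f → ((λ f → a f + c * b f) ↾ y) f ≡ (a ↾ y) f + c * (b ↾ y) f
    split f = trans (if-+ (a f) (c * b f) (incident? G f y)) (cong ((a ↾ y) f +_) (if-* c (b f) (incident? G f y)))

  load-zero : ∀ {d : Fin m → ℚ} → (∀ f → d f ≡ 0ℚ) → ∀ y → load G d y ≡ 0ℚ
  load-zero {d} d≗0 y = trans (load-as-sum d y) (sum-zero λ f → trans (cong (_if incident? G f y) (d≗0 f)) (if-zero (incident? G f y)))

  load-single : ∀ {γ h y} → Incident G h y → (∀ f → f ≢ h → Incident G f y → γ f ≡ 0ℚ) → load G γ y ≡ γ h
  load-single {γ} {h} {y} h∋y others = begin
    load G γ y                           ≡⟨ load-as-sum γ y ⟩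
    sum (γ ↾ y)                          ≡⟨ sum-single h vanish ⟩
    (γ ↾ y) h                            ≡⟨ if-yes (incident? G h y) h∋y ⟩
    γ h                                  ∎
    where
    open ≡-Reasoning
    vanish : ∀ f → f ≢ h → (γ ↾ y) f ≡ 0ℚ
    vanish f f≢h with incident? G f y
    ... | yes f∋y = others f f≢h f∋y
    ... | no _    = refl

  load-pair : ∀ {γ h h′ y} → (∀ f → 0ℚ ≤ γ f) → h ≢ h′ → Incident G h y → Incident G h′ y →
              γ h + γ h′ ≤ load G γ y
  load-pair {γ} {h} {h′} {y} γ≥0 h≢h′ h∋y h′∋y = begin
    γ h + γ h′                 ≡⟨ cong₂ _+_ (if-yes (incident? G h y) h∋y) (if-yes (incident? G h′ y) h′∋y) ⟨
    (γ ↾ y) h + (γ ↾ y) h′     ≤⟨ pair≤sum (λ f → if-nonneg (incident? G f y) (γ≥0 f)) h≢h′ ⟩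
    sum (γ ↾ y)                ≡⟨ load-as-sum γ y ⟨
    load G γ y                 ∎
    where open ℚP.≤-Reasoning

  load-δ : ∀ {h a b} → Joins h a b → ∀ y → load G (δ h) y ≡ δ a y + δ b y
  load-δ {h} {a} {b} h∶ab y = begin
    load G (δ h) y                        ≡⟨ load-as-sum (δ h) y ⟩
    sum (δ h ↾ y)                         ≡⟨ sum-single h vanish ⟩
    (δ h ↾ y) h                           ≡⟨ cong (_if incident? G h y) (δ-self h) ⟩
    1ℚ if incident? G h y                 ≡⟨ endpoints (incident? G h y) ⟩
    δ a y + δ b y                         ∎
    where
    open ≡-Reasoning
    vanish : ∀ f → f ≢ h → (δ h ↾ y) f ≡ 0ℚ
    vanish f f≢h = trans (cong (_if incident? G f y) (δ-≢ (f≢h ∘ sym))) (if-zero (incident? G f y))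
    endpoints : (h∋y? : Dec (Incident G h y)) → 1ℚ if h∋y? ≡ δ a y + δ b y
    endpoints h∋y? with a ≟ y | b ≟ y
    ... | yes refl | yes refl = ⊥-elim (joins-≢ h∶ab refl)
    ... | yes refl | no _     = if-yes h∋y? (joins-incidentˡ h∶ab)
    ... | no _     | yes refl = if-yes h∋y? (joins-incidentʳ h∶ab)
    ... | no a≢y   | no b≢y   = if-no h∋y? λ h∋y → [ a≢y ∘ sym , b≢y ∘ sym ]′ (joins-endpoints h∶ab h∋y)

  module _ (γ : Fin m → ℚ) where

    IsStarCentre : Fin n → Set
    IsStarCentre u = ∀ {g y f} → Supp G γ g → Joins g u y → Supp G γ f → Incident G f y → Incident G f u

    star-centre⇒substar : ∀ {u e} → IsStarCentre u → Supp G γ e → Incident G e u → ComponentIsSubstar G γ e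
    star-centre⇒substar {u} {e} centre e∈supp e∋u = u , component
      where
      Near : Fin n → Set
      Near y = y ≡ u ⊎ ∃ λ g → Supp G γ g × Joins g u y
      at-near : ∀ {f y} → Supp G γ f → Incident G f y → Near y → Incident G f u
      at-near f∈supp f∋y (inj₁ refl)               = f∋y
      at-near f∈supp f∋y (inj₂ (g , g∈supp , g∶uy)) = centre g∈supp g∶uy f∈supp f∋y
      near : ∀ {f y} → Supp G γ f → Incident G f u → Incident G f y → Near y
      near {f} {y} f∈supp f∋u f∋y with y ≟ u
      ... | yes y≡u = inj₁ y≡u
      ... | no y≢u  = inj₂ (f , f∈supp , incident⇒joins f∋u f∋y (y≢u ∘ sym))
      reach-near : ∀ {a b} → Reach G γ a b → Near a → Near b
      reach-near here                              near-a = near-a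
      reach-near (step f f∈supp f∋a f∋w reach) near-a = reach-near reach (near f∈supp (at-near f∈supp f∋a near-a) f∋w)
      component : ∀ e′ → InComponentOf G γ e e′ → Incident G e′ u
      component e′ (e′∈supp , reach) = at-near e′∈supp (inj₁ refl) (reach-near reach (near e∈supp e∋u (inj₁ refl)))

    Slack : Fin n → Set
    Slack y = 1ℚ < load G γ y

    slack? : ∀ y → Dec (Slack y)
    slack? y = 1ℚ ℚP.<? load G γ y

    Supported : (Fin m → ℚ) → Set
    Supported d = ∀ f → d f ≡ 0ℚ ⊎ Supp G γ f

    supported-linear : ∀ {a b} → Supported a → Supported b → ∀ c → Supported (λ f → a f + c * b f)
    supported-linear a-supp b-supp c f with a-supp f | b-supp f
    ... | inj₂ f∈supp | _          = inj₂ f∈supp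
    ... | inj₁ _      | inj₂ f∈supp = inj₂ f∈supp
    ... | inj₁ a≡0    | inj₁ b≡0   = inj₁ (trans (cong₂ (λ x y → x + c * y) a≡0 b≡0) (cong (0ℚ +_) (ℚP.*-zeroʳ c)))

    supported-δ : ∀ {h} → Supp G γ h → Supported (δ h)
    supported-δ {h} h∈supp f with h ≟ f
    ... | yes refl = inj₂ h∈supp
    ... | no _     = inj₁ refl

    record Perturbation : Set where
      field
        direction      : Fin m → ℚ
        within-support : Supported direction
        balanced       : ∀ y → load G direction y ≡ 0ℚ ⊎ Slack y
        nonzero        : ¬ (∀ f → direction f ≡ 0ℚ)

    perturbed-fec : ∀ {d c} → (∀ f → ∣ c * d f ∣ ≤ γ f) → (∀ y → ∣ c * load G d y ∣ ≤ load G γ y - 1ℚ) →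
                    IsFEC G (λ f → γ f + c * d f)
    perturbed-fec {d} {c} edge-room vertex-room =
      (λ f → ∣p∣≤q⇒0≤q+p (edge-room f)) ,
      (λ y → subst (1ℚ ≤_) (sym (load-linear γ d c y)) (∣p∣≤q-r⇒r≤q+p {q = load G γ y} (vertex-room y)))

    extreme⇒¬perturbation : IsExtreme G γ → ¬ Perturbation
    extreme⇒¬perturbation ((γ≥0 , covers) , extreme)
      record { direction = d ; within-support = d∈supp ; balanced = d-balanced ; nonzero = d≢0 }
      with uniform-step d γ γ≥0 d∈supp
         | uniform-step (load G d) (λ y → load G γ y - 1ℚ) (p≤q⇒0≤q-p ∘ covers) (map₂ p<q⇒0<q-p ∘ d-balanced)
    ... | εₑ , 0<εₑ , edge-room | εᵥ , 0<εᵥ , vertex-room = d≢0 λ f → opposite-steps-agree {x = γ f} 0<ε (agree f)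
      where
      ε : ℚ
      ε = εₑ ⊓ εᵥ
      0<ε : 0ℚ < ε
      0<ε = 0<⊓ 0<εₑ 0<εᵥ
      ∣ε∣≤ε : ∣ ε ∣ ≤ ε
      ∣ε∣≤ε = ℚP.≤-reflexive (ℚP.0≤p⇒∣p∣≡p (ℚP.<⇒≤ 0<ε))
      feasible : ∀ {c} → ∣ c ∣ ≤ ε → IsFEC G (λ f → γ f + c * d f)
      feasible {c} ∣c∣≤ε = perturbed-fec {d} {c} (edge-room (ℚP.≤-trans ∣c∣≤ε (ℚP.p⊓q≤p εₑ εᵥ)))
                                     (vertex-room (ℚP.≤-trans ∣c∣≤ε (ℚP.p⊓q≤q εₑ εᵥ)))
      halves : ∀ f → γ f ≡ ½ * (γ f + ε * d f) + (1ℚ - ½) * (γ f + (- ε) * d f)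
      halves f = solve 3 (λ g e x → g := con ½ :* (g :+ e :* x) :+ (con 1ℚ :- con ½) :* (g :+ (:- e) :* x)) refl (γ f) ε (d f)
      agree : ∀ f → γ f + ε * d f ≡ γ f + (- ε) * d f
      agree = extreme _ _ ½ (feasible ∣ε∣≤ε) (feasible (subst (_≤ ε) (sym (ℚP.∣-p∣≡∣p∣ ε)) ∣ε∣≤ε))
                      (ℚP.positive⁻¹ ½) (toWitness {a? = ½ ℚP.<? 1ℚ} _) halves

    tight⇒other-edge<1 : IsFEC G γ → ∀ {b h h′} → ¬ Slack b → Supp G γ h → Incident G h b → Incident G h′ b → h ≢ h′ →
                         γ h′ < 1ℚ
    tight⇒other-edge<1 (γ≥0 , _) {b} {h} {h′} b-tight h∈supp h∋b h′∋b h≢h′ = begin-strict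
      γ h′         ≡⟨ ℚP.+-identityˡ (γ h′) ⟨
      0ℚ + γ h′    <⟨ ℚP.+-monoˡ-< (γ h′) h∈supp ⟩
      γ h + γ h′   ≤⟨ load-pair γ≥0 h≢h′ h∋b h′∋b ⟩
      load G γ b   ≤⟨ ℚP.≮⇒≥ b-tight ⟩
      1ℚ           ∎
      where open ℚP.≤-Reasoning

    only-support-edge⇒load : (∀ f → 0ℚ ≤ γ f) → ∀ {b h} → Incident G h b →
                             (∀ f → Supp G γ f → Incident G f b → f ≡ h) →
                             load G γ b ≡ γ h
    only-support-edge⇒load γ≥0 h∋b only-h =
      load-single h∋b λ f f≢h f∋b → ℚP.≤-antisym (ℚP.≮⇒≥ λ 0<γf → f≢h (only-h f 0<γf f∋b)) (γ≥0 f)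

    pendant⇒1≤γ : IsFEC G γ → ∀ {e v} → PendantAt G γ e v → 1ℚ ≤ γ e
    pendant⇒1≤γ (γ≥0 , covers) {v = v} (_ , e∋v , only-e) = subst (1ℚ ≤_) (only-support-edge⇒load γ≥0 e∋v only-e) (covers v)

    <1⇒other-support-edge : IsFEC G γ → ∀ {b h} → γ h < 1ℚ → Incident G h b →
                            ∃ λ h′ → (Supp G γ h′ × Incident G h′ b) × h′ ≢ h
    <1⇒other-support-edge (γ≥0 , covers) {b} {h} h<1 h∋b
      with any? (λ f → ((0ℚ ℚP.<? γ f) ×-dec incident? G f b) ×-dec ¬? (f ≟ h))
    ... | yes found = found
    ... | no none   = ⊥-elim (ℚP.<-irrefl refl (ℚP.<-≤-trans h<1 1≤γh))
      where
      only-h : ∀ f → Supp G γ f → Incident G f b → f ≡ h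
      only-h f f∈supp f∋b with f ≟ h
      ... | yes f≡h = f≡h
      ... | no f≢h  = ⊥-elim (none (f , (f∈supp , f∋b) , f≢h))
      1≤γh : 1ℚ ≤ γ h
      1≤γh = subst (1ℚ ≤_) (only-support-edge⇒load γ≥0 h∋b only-h) (covers b)

    module AlternatingPaths (u : Fin n) where

      mutual
        data Path : Fin n → Set where
          start  : Path u
          extend : ∀ {a b} (p : Path a) (h : Fin m) → Supp G γ h → Joins h a b → b ∉ vertices p → Path b

        vertices : ∀ {a} → Path a → List (Fin n)
        vertices start                      = u ∷ []
        vertices (extend {b = b} p _ _ _ _) = b ∷ vertices p

      sign : ∀ {a} → Path a → ℚ
      sign start              = 1ℚ
      sign (extend p _ _ _ _) = - sign p

      alternating : ∀ {a} → Path a → Fin m → ℚ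
      alternating start              f = 0ℚ
      alternating (extend p h _ _ _) f = alternating p f + sign p * δ h f

      sign² : ∀ {a} (p : Path a) → sign p * sign p ≡ 1ℚ
      sign² start              = refl
      sign² (extend p _ _ _ _) = trans (solve 1 (λ s → (:- s) :* (:- s) := s :* s) refl (sign p)) (sign² p)

      sign≢0 : ∀ {a} (p : Path a) → sign p ≢ 0ℚ
      sign≢0 p sign≡0 = 1≢0 (trans (sym (sign² p)) (cong (λ s → s * s) sign≡0))

      end∈vertices : ∀ {a} (p : Path a) → a ∈ vertices p
      end∈vertices start              = here refl
      end∈vertices (extend _ _ _ _ _) = here refl

      u∈vertices : ∀ {a} (p : Path a) → u ∈ vertices p
      u∈vertices start              = here refl
      u∈vertices (extend p _ _ _ _) = there (u∈vertices p)

      fresh⇒≢u : ∀ {a b} (p : Path a) → b ∉ vertices p → b ≢ u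
      fresh⇒≢u p b∉p refl = b∉p (u∈vertices p)

      vertices-length≤n : ∀ {a} (p : Path a) → length (vertices p) ℕ.≤ n
      vertices-length≤n p = unique⇒length≤ (unique p)
        where
        unique : ∀ {a} (p : Path a) → Unique (vertices p)
        unique start                  = All.[] ∷ []
        unique (extend p _ _ _ fresh) = ¬Any⇒All¬ (vertices p) fresh ∷ unique p

      prefix : ∀ {a x} (p : Path a) → x ∈ vertices p → ∃ λ (q : Path x) → vertices q ⊆ vertices p
      prefix start              (here refl) = start , λ x∈ → x∈
      prefix (extend p h s j f) (here refl) = extend p h s j f , λ x∈ → x∈
      prefix (extend p _ _ _ _) (there x∈p) with prefix p x∈p
      ... | q , q⊆p = q , there ∘ q⊆p

      proper-prefix : ∀ {a x} (p : Path a) → x ∈ vertices p → x ≢ a → ∃ λ (q : Path x) → a ∉ vertices q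
      proper-prefix start                  (here refl) x≢a = ⊥-elim (x≢a refl)
      proper-prefix (extend _ _ _ _ _)     (here refl) x≢a = ⊥-elim (x≢a refl)
      proper-prefix (extend p _ _ _ fresh) (there x∈p) _   with prefix p x∈p
      ... | q , q⊆p = q , fresh ∘ q⊆p

      neighbour∉start : ∀ {g w} → Joins g u w → w ∉ vertices start
      neighbour∉start g∶uw (here w≡u) = joins-≢ g∶uw (sym w≡u)

      single-edge : ∀ {g w} → Supp G γ g → Joins g u w → Path w
      single-edge g∈supp g∶uw = extend start _ g∈supp g∶uw (neighbour∉start g∶uw)

      alternating-supported : ∀ {a} (p : Path a) → Supported (alternating p)
      alternating-supported start f                 = inj₁ refl
      alternating-supported (extend p _ h∈supp _ _) = supported-linear (alternating-supported p) (supported-δ h∈supp) (sign p)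

      alternating-off : ∀ {a y f} (p : Path a) → y ∉ vertices p → Incident G f y → alternating p f ≡ 0ℚ
      alternating-off start _ _ = refl
      alternating-off {y = y} {f} (extend p h _ h∶ab _) y∉p f∋y = begin
        alternating p f + sign p * δ h f
          ≡⟨ cong₂ (λ x z → x + sign p * z) (alternating-off p (y∉p ∘ there) f∋y) (δ-≢ h≢f) ⟩
        0ℚ + sign p * 0ℚ
          ≡⟨ cong (0ℚ +_) (ℚP.*-zeroʳ (sign p)) ⟩
        0ℚ
          ∎
        where
        open ≡-Reasoning
        h≢f : h ≢ f
        h≢f refl with joins-endpoints h∶ab f∋y
        ... | inj₁ refl = y∉p (there (end∈vertices p))
        ... | inj₂ refl = y∉p (here refl)

      alternating-new-edge : ∀ {a b h f} (p : Path a) (h∈supp : Supp G γ h) (h∶ab : Joins h a b) (b∉p : b ∉ vertices p) →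
                             Incident G f b → f ≢ h → alternating (extend p h h∈supp h∶ab b∉p) f ≡ 0ℚ
      alternating-new-edge p _ _ b∉p f∋b f≢h =
        trans (cong₂ (λ x z → x + sign p * z) (alternating-off p b∉p f∋b) (δ-≢ (f≢h ∘ sym)))
              (solve 1 (λ s → con 0ℚ :+ s :* con 0ℚ := con 0ℚ) refl (sign p))

      load-alternating : ∀ {a} (p : Path a) y → load G (alternating p) y ≡ δ u y - sign p * δ a y
      load-alternating start y = trans (load-zero (λ _ → refl) y) (solve 1 (λ x → con 0ℚ := x :- con 1ℚ :* x) refl (δ u y))
      load-alternating (extend {a} {b} p h _ h∶ab _) y = begin
        load G (λ f → alternating p f + sign p * δ h f) y
          ≡⟨ load-linear (alternating p) (δ h) (sign p) y ⟩
        load G (alternating p) y + sign p * load G (δ h) y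
          ≡⟨ cong₂ (λ x z → x + sign p * z) (load-alternating p y) (load-δ h∶ab y) ⟩
        (δ u y - sign p * δ a y) + sign p * (δ a y + δ b y)
          ≡⟨ solve 4 (λ U s A B → (U :- s :* A) :+ s :* (A :+ B) := U :- (:- s) :* B) refl (δ u y) (sign p) (δ a y) (δ b y) ⟩
        δ u y - (- sign p) * δ b y
          ∎
        where open ≡-Reasoning

      -- With the coefficient sign p * sign q the loads at b cancel (sign q² = 1), leaving 1 + sign p * sign q
      -- at u: 0 when p, h and q close an even cycle, 2 when they close an odd cycle whose stem is counted twice.
      closed-walk : ∀ {a b} → Path a → Path b → Fin m → Fin m → ℚ
      closed-walk p q h f = (alternating p f + (sign p * sign q) * alternating q f) + sign p * δ h f

      closed-walk-supported : ∀ {a b h} (p : Path a) (q : Path b) → Supp G γ h → Supported (closed-walk p q h)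
      closed-walk-supported p q h∈supp =
        supported-linear (supported-linear (alternating-supported p) (alternating-supported q) (sign p * sign q))
                         (supported-δ h∈supp) (sign p)

      load-closed-walk : ∀ {a b h} (p : Path a) (q : Path b) → Joins h a b → ∀ y →
                         load G (closed-walk p q h) y ≡ (1ℚ + sign p * sign q) * δ u y
      load-closed-walk {a} {b} {h} p q h∶ab y = begin
        load G (closed-walk p q h) y
          ≡⟨ load-linear _ (δ h) (sign p) y ⟩
        load G (λ f → alternating p f + c * alternating q f) y + sign p * load G (δ h) y
          ≡⟨ cong₂ (λ l r → l + sign p * r) (load-linear (alternating p) (alternating q) c y) (load-δ h∶ab y) ⟩
        (load G (alternating p) y + c * load G (alternating q) y) + sign p * (δ a y + δ b y)
          ≡⟨ cong₂ (λ l r → (l + c * r) + sign p * (δ a y + δ b y)) (load-alternating p y) (load-alternating q y) ⟩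
        ((δ u y - sign p * δ a y) + c * (δ u y - sign q * δ b y)) + sign p * (δ a y + δ b y)
          ≡⟨ solve 5 (λ U A B s t → ((U :- s :* A) :+ (s :* t) :* (U :- t :* B)) :+ s :* (A :+ B)
                                   := (con 1ℚ :+ s :* t) :* U :+ s :* (con 1ℚ :- t :* t) :* B)
                     refl (δ u y) (δ a y) (δ b y) (sign p) (sign q) ⟩
        (1ℚ + c) * δ u y + sign p * (1ℚ - sign q * sign q) * δ b y
          ≡⟨ cong (λ t² → (1ℚ + c) * δ u y + sign p * (1ℚ - t²) * δ b y) (sign² q) ⟩
        (1ℚ + c) * δ u y + sign p * (1ℚ - 1ℚ) * δ b y
          ≡⟨ solve 4 (λ C U s B → C :* U :+ s :* (con 1ℚ :- con 1ℚ) :* B := C :* U) refl (1ℚ + c) (δ u y) (sign p) (δ b y) ⟩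
        (1ℚ + c) * δ u y
          ∎
        where
        open ≡-Reasoning
        c : ℚ
        c = sign p * sign q

      closed-walk-at-closing-edge : ∀ {a b h} (p : Path a) (q : Path b) → a ∉ vertices q → alternating p h ≡ 0ℚ → Joins h a b →
                                    closed-walk p q h h ≡ sign p
      closed-walk-at-closing-edge {h = h} p q a∉q p[h]≡0 h∶ab = begin
        (alternating p h + c * alternating q h) + sign p * δ h h
          ≡⟨ cong₂ (λ l r → (l + c * r) + sign p * δ h h) p[h]≡0 (alternating-off q a∉q (joins-incidentˡ h∶ab)) ⟩
        (0ℚ + c * 0ℚ) + sign p * δ h h
          ≡⟨ cong (λ r → (0ℚ + c * 0ℚ) + sign p * r) (δ-self h) ⟩
        (0ℚ + c * 0ℚ) + sign p * 1ℚ
          ≡⟨ solve 2 (λ C s → (con 0ℚ :+ C :* con 0ℚ) :+ s :* con 1ℚ := s) refl c (sign p) ⟩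
        sign p
          ∎
        where
        open ≡-Reasoning
        c : ℚ
        c = sign p * sign q

      module _ (extreme : IsExtreme G γ) (u-slack : Slack u) where

        no-perturbation : ¬ Perturbation
        no-perturbation = extreme⇒¬perturbation extreme

        path-perturbation : ∀ {b} (p : Path b) → Slack b → b ≢ u → Perturbation
        path-perturbation {b} p b-slack b≢u = record
          { direction      = alternating p
          ; within-support = alternating-supported p
          ; balanced       = balanced
          ; nonzero        = λ p≡0 → 1≢0 (trans (sym (trans (away-from-b b≢u) (δ-self u))) (load-zero p≡0 u))
          }
          where
          away-from-b : ∀ {y} → b ≢ y → load G (alternating p) y ≡ δ u y
          away-from-b {y} b≢y = trans (load-alternating p y) (trans (cong (λ z → δ u y - sign p * z) (δ-≢ b≢y))
            (solve 2 (λ U s → U :- s :* con 0ℚ := U) refl (δ u y) (sign p)))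
          balanced : ∀ y → load G (alternating p) y ≡ 0ℚ ⊎ Slack y
          balanced y with u ≟ y | b ≟ y
          ... | yes refl | _        = inj₂ u-slack
          ... | no _     | yes refl = inj₂ b-slack
          ... | no u≢y   | no b≢y   = inj₁ (trans (away-from-b b≢y) (δ-≢ u≢y))

        cycle-perturbation : ∀ {a b h} (p : Path a) (q : Path b) → a ∉ vertices q → alternating p h ≡ 0ℚ →
                             Supp G γ h → Joins h a b → Perturbation
        cycle-perturbation {h = h} p q a∉q p[h]≡0 h∈supp h∶ab = record
          { direction      = closed-walk p q h
          ; within-support = closed-walk-supported p q h∈supp
          ; balanced       = balanced
          ; nonzero        = λ walk≡0 → sign≢0 p (trans (sym (closed-walk-at-closing-edge p q a∉q p[h]≡0 h∶ab)) (walk≡0 h))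
          }
          where
          balanced : ∀ y → load G (closed-walk p q h) y ≡ 0ℚ ⊎ Slack y
          balanced y with u ≟ y
          ... | yes refl = inj₂ u-slack
          ... | no u≢y   = inj₁ (trans (load-closed-walk p q h∶ab y)
                                  (trans (cong ((1ℚ + sign p * sign q) *_) (δ-≢ u≢y)) (ℚP.*-zeroʳ (1ℚ + sign p * sign q))))

        -- k bounds the number of further steps, which suffices because a path visits at most n vertices.
        search : ∀ k {a b h} (p : Path a) → Supp G γ h → γ h < 1ℚ → Joins h a b → alternating p h ≡ 0ℚ →
                 n ℕ.≤ k ℕ.+ length (vertices p) → ⊥
        search k {b = b} p h∈supp h<1 h∶ab p[h]≡0 fuel with Any.any? (b ≟_) (vertices p)
        ... | yes b∈p with proper-prefix p b∈p (joins-≢ h∶ab ∘ sym)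
        ...   | q , a∉q = no-perturbation (cycle-perturbation p q a∉q p[h]≡0 h∈supp h∶ab)
        search k {b = b} {h} p h∈supp h<1 h∶ab p[h]≡0 fuel | no b∉p with slack? b | k
        ... | yes b-slack | _        = no-perturbation (path-perturbation (extend p h h∈supp h∶ab b∉p) b-slack (fresh⇒≢u p b∉p))
        ... | no b-tight  | ℕ.zero   = ℕP.<⇒≱ (ℕ.s≤s fuel) (vertices-length≤n (extend p h h∈supp h∶ab b∉p))
        ... | no b-tight  | ℕ.suc k′ with <1⇒other-support-edge (proj₁ extreme) h<1 (joins-incidentʳ h∶ab)
        ...   | h′ , (h′∈supp , h′∋b) , h′≢h =
          search k′ (extend p h h∈supp h∶ab b∉p) h′∈supp
            (tight⇒other-edge<1 (proj₁ extreme) b-tight h∈supp (joins-incidentʳ h∶ab) h′∋b (h′≢h ∘ sym))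
            (proj₂ (other-endpoint h′∋b)) (alternating-new-edge p h∈supp h∶ab b∉p h′∋b h′≢h)
            (subst (n ℕ.≤_) (sym (ℕP.+-suc k′ _)) fuel)

        slack⇒neighbours-are-leaves : ∀ {g w f} → Supp G γ g → Joins g u w → Supp G γ f → Incident G f w → Incident G f u
        slack⇒neighbours-are-leaves {g} {w} {f} g∈supp g∶uw f∈supp f∋w with other-endpoint f∋w
        ... | x , f∶wx with x ≟ u
        ...   | yes refl = joins-incidentʳ f∶wx
        ...   | no x≢u with slack? w
        ...     | yes w-slack = ⊥-elim (no-perturbation (path-perturbation (single-edge g∈supp g∶uw) w-slack (joins-≢ g∶uw ∘ sym)))
        ...     | no w-tight  = ⊥-elim (search n (single-edge g∈supp g∶uw) f∈supp
                                   (tight⇒other-edge<1 (proj₁ extreme) w-tight g∈supp (joins-incidentʳ g∶uw) f∋w (f≢g ∘ sym)) f∶wx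
                                   (alternating-new-edge start g∈supp g∶uw (neighbour∉start g∶uw) f∋w f≢g) (ℕP.m≤m+n n 2))
          where
          f≢g : f ≢ g
          f≢g refl = [ x≢u , joins-≢ f∶wx ∘ sym ]′ (joins-endpoints g∶uw (joins-incidentʳ f∶wx))

    pendant⇒star-centre : IsExtreme G γ → ∀ {e v u} → PendantAt G γ e v → Joins e v u → IsStarCentre u
    pendant⇒star-centre extreme@(fec , _) {e} {v} {u} pendant@(_ , _ , only-e) e∶vu {g} {y} {f} g∈supp g∶uy f∈supp f∋y
      with g ≟ e
    ... | yes refl = subst (λ f → Incident G f u) (sym (only-e f f∈supp f∋v)) (joins-incidentʳ e∶vu)
      where
      y≡v : y ≡ v
      y≡v = fromInj₁ (λ y≡u → ⊥-elim (joins-≢ g∶uy (sym y≡u))) (joins-endpoints e∶vu (joins-incidentʳ g∶uy))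
      f∋v : Incident G f v
      f∋v = subst (Incident G f) y≡v f∋y
    ... | no g≢e = AlternatingPaths.slack⇒neighbours-are-leaves u extreme u-slack g∈supp g∶uy f∈supp f∋y
      where
      u-slack : Slack u
      u-slack = begin-strict
        1ℚ + 0ℚ     <⟨ ℚP.+-mono-≤-< (pendant⇒1≤γ fec pendant) g∈supp ⟩
        γ e + γ g   ≤⟨ load-pair (proj₁ fec) (g≢e ∘ sym) (joins-incidentʳ e∶vu) (joins-incidentˡ g∶uy) ⟩
        load G γ u  ∎
        where open ℚP.≤-Reasoning

lemma5 : (G : Graph) (γ : Fin (Graph.m G) → ℚ) → IsExtreme G γ →
    (e : Fin (Graph.m G)) (v : Fin (Graph.n G)) → PendantAt G γ e v →
    ComponentIsSubstar G γ e
lemma5 G γ extreme e v pendant@(e∈supp , e∋v , _) with other-endpoint G e∋v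
... | u , e∶vu = star-centre⇒substar G γ (pendant⇒star-centre G γ extreme pendant e∶vu) e∈supp (joins-incidentʳ G e∶vu)
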